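{- If $G$ is a connected graph of order at least $2$ and $m\ge 2$, then $\mathrm{gp}_{\rm o}(G\circ K_m)=m\cdot\mathrm{gp}_{\rm o}(G)$.
   Context: All graphs are finite and simple. For $X\subseteq V(G)$, two vertices $u,v$ are $X$-positionable if no shortest $u,v$-path has an internal vertex in $X$. $X$ is an outer general position set if every two vertices of $X$ are $X$-positionable and every $u\in X$, $v\in V(G)\setminus X$ are $X$-positionable; $\mathrm{gp}_{\rm o}$ is the maximum cardinality of such a set. The lexicographic product $G\circ H$ has vertex set $V(G)\times V(H)$, with $(g,h)$ and $(g',h')$ adjacent iff either $gg'\in E(G)$, or $g=g'$ and $hh'\in E(H)$. $K_m$ is the complete graph on $m$ vertices. -}

module Defs where

open import Data.Nat using (ℕ; zero; suc; _*_; _≤_; _<_)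
open import Data.Bool using (Bool; true; false; not; _∧_; _∨_)
open import Data.Fin using (Fin; remQuot)
open import Data.Fin.Properties using (_≟_)
open import Data.Fin.Subset using (Subset; _∈_; _∉_; ∣_∣)
open import Data.Product using (Σ; ∃; _×_; _,_; proj₁; proj₂)
open import Data.List using (List; []; _∷_)
import Data.List.Membership.Propositional as LM
open import Relation.Binary.PropositionalEquality using (_≡_)
open import Relation.Nullary.Decidable using (⌊_⌋)

record Graph : Set where
  constructor mkGraph
  field
    order : ℕ
    adj   : Fin order → Fin order → Bool
open Graph public

IsSimple : Graph → Set
IsSimple G = (∀ u v → adj G u v ≡ adj G v u) × (∀ u → adj G u u ≡ false)

data Walk (G : Graph) : Fin (order G) → Fin (order G) → ℕ → Set where
  nil  : ∀ {u} → Walk G u u zero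
  cons : ∀ {u w v k} → adj G u w ≡ true → Walk G w v k → Walk G u v (suc k)

inner : ∀ {G u v k} → Walk G u v k → List (Fin (order G))
inner nil = []
inner (cons _ nil) = []
inner (cons {w = w} _ p@(cons _ _)) = w ∷ inner p

Connected : Graph → Set
Connected G = ∀ u v → ∃ λ k → Walk G u v k

-- A walk of length k is a shortest u,v-path if no u,v-walk is shorter
-- (a shortest walk is automatically a path).
IsShortest : ∀ {G u v k} → Walk G u v k → Set
IsShortest {G} {u} {v} {k} _ = ∀ k' → Walk G u v k' → k ≤ k'

Positionable : (G : Graph) → Subset (order G) → Fin (order G) → Fin (order G) → Set
Positionable G X u v =
  ∀ k (P : Walk G u v k) → IsShortest P → ∀ x → x LM.∈ inner P → x ∉ X

IsOuterGP : (G : Graph) → Subset (order G) → Set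
IsOuterGP G X =
  (∀ u v → u ∈ X → v ∈ X → Positionable G X u v) ×
  (∀ u v → u ∈ X → v ∉ X → Positionable G X u v)

IsGpo : Graph → ℕ → Set
IsGpo G k =
  (Σ (Subset (order G)) λ X → IsOuterGP G X × ∣ X ∣ ≡ k) ×
  (∀ X → IsOuterGP G X → ∣ X ∣ ≤ k)

K : ℕ → Graph
K m = mkGraph m (λ i j → not ⌊ i ≟ j ⌋)

-- Lexicographic product G ∘ H, vertex (g , h) encoded as combine g h : Fin (|G| * |H|).
_∘ₗ_ : Graph → Graph → Graph
G ∘ₗ H = mkGraph (order G * order H) λ x y →
  let (g , h)   = remQuot (order H) x
      (g' , h') = remQuot (order H) y
  in adj G g g' ∨ (⌊ g ≟ g' ⌋ ∧ adj H h h')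

-- In G ∘ K_m two vertices in different fibres {g} × V(K_m) are adjacent exactly when their
-- projections are adjacent in G, and two distinct vertices in the same fibre are adjacent.
-- Hence shortest paths of length at least 2 project to shortest paths of G of the same length,
-- and shortest paths of G lift to shortest paths between any two vertices of the end fibres.
-- So the full preimage of an outer general position set of G is one of G ∘ K_m, of m times the
-- size; conversely the projection of an outer general position set of G ∘ K_m is one of G, and
-- each of its fibres holds at most m vertices. The argument never uses connectivity,
-- simplicity, the order of G or m ≥ 2.
module Submission where

open import Defs
open import Data.Nat using (ℕ; zero; suc; _+_; _*_; _≤_; z≤n; s≤s)
open import Data.Nat.Properties
open import Data.Bool using (true; false)
open import Data.Fin using (Fin; combine; quotient; remainder)
open import Data.Fin.Properties using (remQuot-combine; combine-remQuot) renaming (_≟_ to _≟ᶠ_)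
open import Data.Fin.Subset using (Subset; Side; inside; outside; _∈_; ∣_∣; ⊤; ⊥; Nonempty)
open import Data.Fin.Subset.Properties using (_∈?_; nonempty?; Empty-unique; ∣⊤∣≡n; ∣⊥∣≡0; ∣p∣≤n)
open import Data.Product using (Σ; ∃; ∃₂; _×_; _,_; proj₁; proj₂)
open import Data.Sum using (_⊎_; inj₁; inj₂)
open import Data.Empty using (⊥-elim)
open import Data.List.Relation.Unary.Any using (here; there)
import Data.List.Membership.Propositional as List
open import Data.Vec using (Vec; []; _∷_; _++_; concat; map; replicate; lookup; group)
open import Data.Vec.Properties using (lookup-concat; lookup-map; lookup-replicate; []=⇒lookup; lookup⇒[]=)
open import Relation.Binary.PropositionalEquality
open import Relation.Nullary using (yes; no)
open import Relation.Nullary.Decidable using (⌊_⌋)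

_++ʷ_ : ∀ {G u w v a b} → Walk G u w a → Walk G w v b → Walk G u v (a + b)
nil      ++ʷ q = q
cons e p ++ʷ q = cons e (p ++ʷ q)

junction-∈-inner : ∀ {G u w v a b} (p : Walk G u w (suc a)) (q : Walk G w v (suc b)) →
                   w List.∈ inner (p ++ʷ q)
junction-∈-inner (cons _ nil)            (cons _ _) = here refl
junction-∈-inner (cons _ p@(cons _ _)) q          = there (junction-∈-inner p q)

∈-inner⇒split : ∀ {G u v k} (W : Walk G u v k) {x} → x List.∈ inner W →
                ∃₂ λ a b → Walk G u x (suc a) × Walk G x v (suc b) × k ≡ suc a + suc b
∈-inner⇒split (cons e W@(cons _ _)) (here refl) = 0 , _ , cons e nil , W , refl
∈-inner⇒split (cons e W@(cons _ _)) (there x∈W) with ∈-inner⇒split W x∈W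
... | a , b , W₁ , W₂ , refl = suc a , b , cons e W₁ , W₂ , refl

nil-endpoints : ∀ {G u v} → Walk G u v 0 → u ≡ v
nil-endpoints nil = refl

outerGP⇒positionable : ∀ {G X u} → IsOuterGP G X → u ∈ X → ∀ v → Positionable G X u v
outerGP⇒positionable {X = X} (in-in , in-out) u∈X v with v ∈? X
... | yes v∈X = in-in _ v u∈X v∈X
... | no  v∉X = in-out _ v u∈X v∉X

positionable⇒outerGP : ∀ {G X} → (∀ u v → u ∈ X → Positionable G X u v) → IsOuterGP G X
positionable⇒outerGP pos = (λ u v u∈X _ → pos u v u∈X) , (λ u v u∈X _ → pos u v u∈X)

∈-transport : ∀ {a b} {p : Subset a} {q : Subset b} {x y} →
              lookup q y ≡ lookup p x → x ∈ p → y ∈ q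
∈-transport eq x∈p = lookup⇒[]= _ _ (trans eq ([]=⇒lookup x∈p))

∣p++q∣≡∣p∣+∣q∣ : ∀ {a b} (p : Subset a) (q : Subset b) → ∣ p ++ q ∣ ≡ ∣ p ∣ + ∣ q ∣
∣p++q∣≡∣p∣+∣q∣ []            q = refl
∣p++q∣≡∣p∣+∣q∣ (inside  ∷ p) q = cong suc (∣p++q∣≡∣p∣+∣q∣ p q)
∣p++q∣≡∣p∣+∣q∣ (outside ∷ p) q = ∣p++q∣≡∣p∣+∣q∣ p q

blowUp : ∀ {n} m → Subset n → Subset (n * m)
blowUp m X = concat (map (replicate m) X)

lookup-blowUp : ∀ {n} m (X : Subset n) x → lookup (blowUp m X) x ≡ lookup X (quotient {n} m x)
lookup-blowUp {n} m X x = begin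
  lookup (blowUp m X) x                          ≡⟨ cong (lookup (blowUp m X)) (combine-remQuot {n} m x) ⟨
  lookup (blowUp m X) (combine q r)              ≡⟨ lookup-concat (map (replicate m) X) q r ⟩
  lookup (lookup (map (replicate m) X) q) r      ≡⟨ cong (λ row → lookup row r) (lookup-map q (replicate m) X) ⟩
  lookup (replicate m (lookup X q)) r            ≡⟨ lookup-replicate r (lookup X q) ⟩
  lookup X q                                     ∎
  where
  open ≡-Reasoning
  q = quotient {n} m x
  r = remainder {n} m x

∈-blowUp⁻ : ∀ {n} m {X : Subset n} {x} → x ∈ blowUp m X → quotient {n} m x ∈ X
∈-blowUp⁻ m {X} {x} = ∈-transport (sym (lookup-blowUp m X x))

∣blowUp∣ : ∀ {n} m (X : Subset n) → ∣ blowUp m X ∣ ≡ m * ∣ X ∣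
∣blowUp∣ m [] = sym (*-zeroʳ m)
∣blowUp∣ m (inside ∷ X) = begin
  ∣ ⊤ {m} ++ blowUp m X ∣      ≡⟨ ∣p++q∣≡∣p∣+∣q∣ (⊤ {m}) (blowUp m X) ⟩
  ∣ ⊤ {m} ∣ + ∣ blowUp m X ∣   ≡⟨ cong₂ _+_ (∣⊤∣≡n m) (∣blowUp∣ m X) ⟩
  m + m * ∣ X ∣                ≡⟨ *-suc m ∣ X ∣ ⟨
  m * suc ∣ X ∣                ∎
  where open ≡-Reasoning
∣blowUp∣ m (outside ∷ X) =
  trans (∣p++q∣≡∣p∣+∣q∣ (⊥ {m}) (blowUp m X)) (cong₂ _+_ (∣⊥∣≡0 m) (∣blowUp∣ m X))

occupied : ∀ {m} → Subset m → Side
occupied r = ⌊ nonempty? r ⌋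

occupied⇒nonempty : ∀ {m} (r : Subset m) → occupied r ≡ inside → Nonempty r
occupied⇒nonempty r _ with nonempty? r
... | yes ne = ne

∣concat∣≤m*∣occupied∣ : ∀ {n m} (rows : Vec (Subset m) n) →
                         ∣ concat rows ∣ ≤ m * ∣ map occupied rows ∣
∣concat∣≤m*∣occupied∣ [] = z≤n
∣concat∣≤m*∣occupied∣ {m = m} (r ∷ rows) with nonempty? r
... | yes _ = begin
  ∣ r ++ concat rows ∣                  ≡⟨ ∣p++q∣≡∣p∣+∣q∣ r (concat rows) ⟩
  ∣ r ∣ + ∣ concat rows ∣               ≤⟨ +-mono-≤ (∣p∣≤n r) (∣concat∣≤m*∣occupied∣ rows) ⟩
  m + m * ∣ map occupied rows ∣         ≡⟨ *-suc m _ ⟨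
  m * suc ∣ map occupied rows ∣         ∎
  where open ≤-Reasoning
... | no empty = begin
  ∣ r ++ concat rows ∣                  ≡⟨ ∣p++q∣≡∣p∣+∣q∣ r (concat rows) ⟩
  ∣ r ∣ + ∣ concat rows ∣               ≡⟨ cong (λ p → ∣ p ∣ + ∣ concat rows ∣) (Empty-unique empty) ⟩
  ∣ ⊥ {m} ∣ + ∣ concat rows ∣           ≡⟨ cong (_+ ∣ concat rows ∣) (∣⊥∣≡0 m) ⟩
  ∣ concat rows ∣                       ≤⟨ ∣concat∣≤m*∣occupied∣ rows ⟩
  m * ∣ map occupied rows ∣             ∎
  where open ≤-Reasoning

shadow : ∀ {n} m → Subset (n * m) → Subset n
shadow {n} m Y = map occupied (proj₁ (group n m Y))

∣Y∣≤m*∣shadow∣ : ∀ {n} m (Y : Subset (n * m)) → ∣ Y ∣ ≤ m * ∣ shadow {n} m Y ∣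
∣Y∣≤m*∣shadow∣ {n} m Y with group n m Y
... | rows , Y≡ =
  subst (λ Z → ∣ Z ∣ ≤ m * ∣ map occupied rows ∣) (sym Y≡) (∣concat∣≤m*∣occupied∣ rows)

∈-occupied⇒ : ∀ {n m} (rows : Vec (Subset m) n) g → g ∈ map occupied rows →
              ∃ λ h → combine g h ∈ concat rows
∈-occupied⇒ rows g g∈
  with occupied⇒nonempty (lookup rows g) (trans (sym (lookup-map g occupied rows)) ([]=⇒lookup g∈))
... | h , h∈row = h , ∈-transport (lookup-concat rows g h) h∈row

∈-shadow⇒ : ∀ {n} m (Y : Subset (n * m)) g → g ∈ shadow {n} m Y → ∃ λ h → combine g h ∈ Y
∈-shadow⇒ {n} m Y g g∈ with ∈-occupied⇒ (proj₁ (group n m Y)) g g∈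
... | h , h∈ = h , subst (combine g h ∈_) (sym (proj₂ (group n m Y))) h∈

2≤suc+suc : ∀ a b → 2 ≤ suc a + suc b
2≤suc+suc a b = s≤s (≤-trans (s≤s z≤n) (m≤n+m (suc b) a))

+-tight : ∀ {p q a b} → p ≤ a → q ≤ b → a + b ≤ p + q → p ≡ a × q ≡ b
+-tight {p} {q} {a} {b} p≤a q≤b a+b≤p+q = p≡a , q≡b
  where
  p≡a : p ≡ a
  p≡a = ≤-antisym p≤a (+-cancelʳ-≤ b a p (≤-trans a+b≤p+q (+-monoʳ-≤ p q≤b)))
  q≡b : q ≡ b
  q≡b = ≤-antisym q≤b (+-cancelˡ-≤ a b q (≤-trans a+b≤p+q (+-monoˡ-≤ q p≤a)))

module LexicographicByComplete (G : Graph) (m : ℕ) where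

  P : Graph
  P = G ∘ₗ K m

  π : Fin (order G * m) → Fin (order G)
  π = quotient m

  ρ : Fin (order G * m) → Fin m
  ρ = remainder {order G} m

  π-combine : ∀ g h → π (combine g h) ≡ g
  π-combine g h = cong proj₁ (remQuot-combine g h)

  adj-base⇒adj : ∀ {u v} → adj G (π u) (π v) ≡ true → adj P u v ≡ true
  adj-base⇒adj e rewrite e = refl

  adj⇒adj-base⊎same-fibre : ∀ {u v} → adj P u v ≡ true → adj G (π u) (π v) ≡ true ⊎ π u ≡ π v
  adj⇒adj-base⊎same-fibre {u} {v} e with adj G (π u) (π v) | π u ≟ᶠ π v
  ... | true  | _       = inj₁ refl
  ... | false | yes π≡ = inj₂ π≡

  same-fibre⇒adj : ∀ {u v} → π u ≡ π v → u ≢ v → adj P u v ≡ true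
  same-fibre⇒adj {u} {v} π≡ u≢v with adj G (π u) (π v) | π u ≟ᶠ π v | ρ u ≟ᶠ ρ v
  ... | true  | _        | _      = refl
  ... | false | no π≢    | _      = ⊥-elim (π≢ π≡)
  ... | false | yes _    | no _   = refl
  ... | false | yes π≡'  | yes ρ≡ = ⊥-elim (u≢v (begin
    u                  ≡⟨ combine-remQuot {order G} m u ⟨
    combine (π u) (ρ u) ≡⟨ cong₂ combine π≡' ρ≡ ⟩
    combine (π v) (ρ v) ≡⟨ combine-remQuot {order G} m v ⟩
    v                  ∎))
    where open ≡-Reasoning

  projectWalk : ∀ {u v j} → Walk P u v j → ∃ λ j' → j' ≤ j × Walk G (π u) (π v) j'
  projectWalk nil = 0 , z≤n , nil
  projectWalk (cons e W) with projectWalk W | adj⇒adj-base⊎same-fibre e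
  ... | j' , j'≤ , W' | inj₁ e'  = suc j' , s≤s j'≤ , cons e' W'
  ... | j' , j'≤ , W' | inj₂ π≡ = j' , m≤n⇒m≤1+n j'≤ , subst (λ g → Walk G g _ j') (sym π≡) W'

  liftWalk : ∀ {g g' j} → Walk G g g' (suc j) → ∀ {u v} → π u ≡ g → π v ≡ g' → Walk P u v (suc j)
  liftWalk (cons e nil) refl refl = cons (adj-base⇒adj e) nil
  liftWalk (cons {w = w} e W@(cons _ _)) {u} refl π-v =
    cons (adj-base⇒adj (subst (λ g → adj G (π u) g ≡ true) (sym (π-combine w (ρ u))) e))
         (liftWalk W (π-combine w (ρ u)) π-v)

  same-fibre-walk : ∀ u v → π u ≡ π v → ∃ λ j → j ≤ 1 × Walk P u v j
  same-fibre-walk u v π≡ with u ≟ᶠ v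
  ... | yes refl = 0 , z≤n , nil
  ... | no u≢v   = 1 , ≤-refl , cons (same-fibre⇒adj π≡ u≢v) nil

  shortest-≤-base-walk : ∀ {u v k} (W : Walk P u v k) → IsShortest W → 2 ≤ k →
                         ∀ j → Walk G (π u) (π v) j → k ≤ j
  shortest-≤-base-walk {u} {v} W W-min 2≤k zero B with same-fibre-walk u v (nil-endpoints B)
  ... | j , j≤1 , V = ⊥-elim (1+n≰n (≤-trans 2≤k (≤-trans (W-min j V) j≤1)))
  shortest-≤-base-walk W W-min 2≤k (suc j) B = W-min (suc j) (liftWalk B refl refl)

  shortest-projects : ∀ {u v k x} (W : Walk P u v k) → IsShortest W → x List.∈ inner W →
                      Σ (Walk G (π u) (π v) k) λ B → IsShortest B × π x List.∈ inner B
  shortest-projects W W-min x∈W with ∈-inner⇒split W x∈W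
  ... | a , b , W₁ , W₂ , refl
    with shortest-≤-base-walk W W-min (2≤suc+suc a b) | projectWalk W₁ | projectWalk W₂
  ... | W≤ | p , p≤ , B₁ | q , q≤ , B₂ with +-tight p≤ q≤ (W≤ (p + q) (B₁ ++ʷ B₂))
  ... | refl , refl = B₁ ++ʷ B₂ , W≤ , junction-∈-inner B₁ B₂

  shortest-lifts : ∀ {g g' k z} (B : Walk G g g' k) → IsShortest B → z List.∈ inner B →
                   ∀ {u v y} → π u ≡ g → π v ≡ g' → π y ≡ z →
                   Σ (Walk P u v k) λ W → IsShortest W × y List.∈ inner W
  shortest-lifts B B-min z∈B π-u π-v π-y with ∈-inner⇒split B z∈B
  ... | a , b , B₁ , B₂ , refl =
    W₁ ++ʷ W₂ , W-min , junction-∈-inner W₁ W₂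
    where
    W₁ = liftWalk B₁ π-u π-y
    W₂ = liftWalk B₂ π-y π-v
    W-min : IsShortest (W₁ ++ʷ W₂)
    W-min k' W' with projectWalk W'
    ... | j , j≤k' , B' = ≤-trans (B-min j (subst₂ (λ g g' → Walk G g g' j) π-u π-v B')) j≤k'

  blowUp-outerGP : ∀ X → IsOuterGP G X → IsOuterGP P (blowUp m X)
  blowUp-outerGP X X-gp = positionable⇒outerGP positionable
    where
    positionable : ∀ u v → u ∈ blowUp m X → Positionable P (blowUp m X) u v
    positionable u v u∈ k W W-min x x∈W x∈ with shortest-projects W W-min x∈W
    ... | B , B-min , πx∈B =
      outerGP⇒positionable X-gp (∈-blowUp⁻ m u∈) (π v) k B B-min (π x) πx∈B (∈-blowUp⁻ m x∈)

  shadow-outerGP : ∀ Y → IsOuterGP P Y → IsOuterGP G (shadow m Y)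
  shadow-outerGP Y Y-gp = positionable⇒outerGP positionable
    where
    positionable : ∀ g g' → g ∈ shadow m Y → Positionable G (shadow m Y) g g'
    positionable g g' g∈ k B B-min z z∈B z∈ with ∈-shadow⇒ m Y g g∈ | ∈-shadow⇒ m Y z z∈
    ... | h , u∈Y | h' , y∈Y
      with shortest-lifts B B-min z∈B (π-combine g h) (π-combine g' h) (π-combine z h')
    ... | W , W-min , y∈W = outerGP⇒positionable Y-gp u∈Y (combine g' h) k W W-min _ y∈W y∈Y

theorem5p6 : (G : Graph) → IsSimple G → Connected G → 2 ≤ order G →
    (m : ℕ) → 2 ≤ m → (k : ℕ) → IsGpo G k → IsGpo (G ∘ₗ K m) (m * k)
theorem5p6 G _ _ _ m _ k ((X , X-gp , ∣X∣≡k) , X-max) =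
  (blowUp m X , blowUp-outerGP X X-gp , trans (∣blowUp∣ m X) (cong (m *_) ∣X∣≡k)) ,
  λ Y Y-gp → ≤-trans (∣Y∣≤m*∣shadow∣ {order G} m Y)
                     (*-monoʳ-≤ m (X-max (shadow m Y) (shadow-outerGP Y Y-gp)))
  where open LexicographicByComplete G m
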